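{- Let $G$ be a signed digraph on vertex set $V$ all of whose cycles are negative. Then $G$ is robustly converging: for every nonempty set $\mathcal F$ of BNs on $V$ such that $G(f)$ is a spanning subgraph of $G$ for all $f\in\mathcal F$, the union $\bigcup_{f\in\mathcal F}\Gamma(f)$ has a unique attractor.
   Context: A signed digraph $G=(V,E)$ has finite vertex set $V$ and arcs $E\subseteq V\times V\times\{ -1,1\}$ ($(j,i,s)$: arc from $j$ to $i$ of sign $s$). Cycles are simple; sign = product of arc signs. A spanning subgraph of $G$ is a signed digraph $(V,E')$ with $E'\subseteq E$. A BN on $V$ is $f:\{0,1\}^V\to\{0,1\}^V$; $G(f)$ has a positive (negative) arc from $j$ to $i$ iff for some $x$ with $x_j=0$, $f_i(x+e_j)-f_i(x)$ is positive (negative) ($e_j$ = configuration equal to $1$ only at $j$, $+$ mod 2). $\Gamma(f)$ is the digraph on $\{0,1\}^V$ with arcs $x\to x+e_i$ whenever $f_i(x)\neq x_i$. The union of such digraphs has vertex set $\{0,1\}^V$ and the union of their arc sets. For a digraph on $\{0,1\}^V$, a trap set is a set with no outgoing arc and an attractor is an inclusion-minimal nonempty trap set. -}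

module Defs where

open import Data.Nat using (ℕ; zero; suc)
open import Data.Nat.DivMod using (_%_; m%n<n)
open import Data.Fin using (Fin; toℕ; fromℕ<)
open import Data.Bool using (Bool; true; false; not)
open import Data.Vec using (Vec; lookup; updateAt)
open import Data.List using (List; [])
open import Data.List.Membership.Propositional using (_∈_)
open import Data.Sign using (Sign) renaming (_*_ to _*ₛ_)
open import Data.Product using (Σ; ∃; _×_; _,_)
open import Relation.Binary.PropositionalEquality using (_≡_; _≢_)
open import Relation.Unary using (Pred; _⊆_)
open import Relation.Nullary using (¬_)
open import Function.Definitions using (Injective)
open import Level using (0ℓ)

-- A signed digraph on vertex set Fin n: arcs (j , i , s) given as a relation
-- Arc j i s  meaning "there is an arc from j to i of sign s".
record SignedDigraph (n : ℕ) : Set₁ where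
  field
    Arc : Fin n → Fin n → Sign → Set
open SignedDigraph public

next : ∀ {k} → Fin (suc k) → Fin (suc k)
next {k} i = fromℕ< (m%n<n (suc (toℕ i)) (suc k))

signProd : ∀ k → (Fin k → Sign) → Sign
signProd zero    s = Sign.+
signProd (suc k) s = s Fin.zero *ₛ signProd k (λ i → s (Fin.suc i))

-- A (simple) cycle: distinct vertices v₀ … v_len, with an arc of sign sgn i
-- from v_i to v_{i+1 mod (len+1)}.  Loops are cycles with len = 0.
record Cycle {n : ℕ} (G : SignedDigraph n) : Set where
  field
    len   : ℕ
    vtx   : Fin (suc len) → Fin n
    sgn   : Fin (suc len) → Sign
    inj   : Injective _≡_ _≡_ vtx
    arcs  : ∀ i → Arc G (vtx i) (vtx (next i)) (sgn i)

cycleSign : ∀ {n} {G : SignedDigraph n} → Cycle G → Sign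
cycleSign c = signProd (suc (Cycle.len c)) (Cycle.sgn c)

AllCyclesNegative : ∀ {n} → SignedDigraph n → Set
AllCyclesNegative G = (c : Cycle G) → cycleSign c ≡ Sign.-

Config : ℕ → Set
Config n = Vec Bool n

BN : ℕ → Set
BN n = Config n → Config n

flipAt : ∀ {n} → Fin n → Config n → Config n
flipAt j x = updateAt x j not

-- value of f_i(x) before and after the increase of x_j, for each sign:
-- positive: f_i goes 0 → 1; negative: f_i goes 1 → 0.
before : Sign → Bool
before Sign.+ = false
before Sign.- = true

GraphOf : ∀ {n} → BN n → SignedDigraph n
GraphOf f = record
  { Arc = λ j i s → Σ (Config _) λ x →
      (lookup x j ≡ false)
      × (lookup (f x) i ≡ before s)
      × (lookup (f (flipAt j x)) i ≡ not (before s)) }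

SpanningSubgraph : ∀ {n} → SignedDigraph n → SignedDigraph n → Set
SpanningSubgraph H G = ∀ j i s → Arc H j i s → Arc G j i s

UnionArc : ∀ {n} → List (BN n) → Config n → Config n → Set
UnionArc F x y = Σ (BN _) λ f → f ∈ F × Σ (Fin _) λ i →
  (lookup (f x) i ≢ lookup x i) × (y ≡ flipAt i x)

Subset : ℕ → Set₁
Subset n = Pred (Config n) 0ℓ

IsTrapSet : ∀ {n} → (Config n → Config n → Set) → Subset n → Set
IsTrapSet R T = ∀ x y → T x → R x y → T y

Nonempty : ∀ {n} → Subset n → Set
Nonempty T = ∃ λ x → T x

IsAttractor : ∀ {n} → (Config n → Config n → Set) → Subset n → Set₁
IsAttractor R A = Nonempty A × IsTrapSet R A
  × (∀ (T : Subset _) → Nonempty T → IsTrapSet R T → T ⊆ A → A ⊆ T)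

SameSet : ∀ {n} → Subset n → Subset n → Set
SameSet A B = A ⊆ B × B ⊆ A

HasUniqueAttractor : ∀ {n} → (Config n → Config n → Set) → Set₁
HasUniqueAttractor R = Σ (Subset _) λ A → IsAttractor R A
  × (∀ B → IsAttractor R B → SameSet A B)

RobustlyConverging : ∀ {n} → SignedDigraph n → Set₁
RobustlyConverging G = ∀ (F : List (BN _)) → ¬ (F ≡ [])
  → (∀ f → f ∈ F → SpanningSubgraph (GraphOf f) G)
  → HasUniqueAttractor (UnionArc F)

{-# OPTIONS --safe #-}
-- Any two configurations x, y have a common descendant: as long as some f ∈ F updates x (or y)
-- on a coordinate where they differ, that step shrinks their Hamming distance.  Otherwise every
-- f ∈ F fixes both x and y on their difference set Δ.  Walking from x to y one coordinate of Δ
-- at a time, each f_i with i ∈ Δ must change value somewhere, which gives an arc j → i of G(f)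
-- with j ∈ Δ and sign σ(x_j) σ(x_i).  Following such arcs backwards closes a cycle of G whose
-- sign telescopes to +, which is impossible; so Δ is empty.  Pairwise joinability on the finite
-- hypercube yields a configuration reachable from everywhere, and the configurations reachable
-- from it form the unique attractor.
module Submission where

open import Defs
open import Data.Nat using (ℕ)

open import Level using (0ℓ)
open import Data.Nat.Base using (zero; suc; _+_; _∸_; _<_; s≤s; s≤s⁻¹)
open import Data.Nat.Properties
  using (n<1+n; +-suc; +-identityʳ; +-monoʳ-<; +-cancelˡ-≡; +-∸-assoc; m+[n∸m]≡n; m∸n≤m; n∸n≡0;
         ∸-cancelˡ-≡; m≤n⇒m<n∨m≡n; <-cmp; anyUpTo?)
open import Data.Nat.Induction using (<-wellFounded)
open import Data.Nat.DivMod using (_%_; m<n⇒m%n≡m; n%n≡0)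
open import Data.Fin.Base as Fin using (Fin; toℕ; fromℕ; inject₁)
open import Data.Fin.Properties using (toℕ-injective; toℕ-fromℕ<; toℕ-fromℕ; toℕ-inject₁; toℕ<n; any?; pigeonhole)
  renaming (_≟_ to _≟ᶠ_)
open import Data.Bool.Base using (Bool; true; false; not; _xor_; if_then_else_)
open import Data.Bool.Properties using (_≟_; not-involutive; ¬-not; xor-comm)
open import Data.Vec.Base using ([]; _∷_; lookup; replicate)
open import Data.Vec.Properties using (lookup∘updateAt; lookup∘updateAt′; updateAt-updateAt; updateAt-id-local)
open import Data.Vec.Relation.Binary.Pointwise.Extensional using (ext; Pointwise-≡⇒≡)
open import Data.List.Base using (List; []; _∷_; [_]; map; _++_)
open import Data.List.Membership.Propositional using (_∈_; find; lose)
open import Data.List.Membership.Propositional.Properties using (∈-map⁺; ∈-++⁺ˡ; ∈-++⁺ʳ)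
open import Data.List.Relation.Unary.Any as Any using (here; there)
open import Data.Product using (Σ; ∃; _×_; _,_; proj₁; proj₂)
open import Data.Sum using (_⊎_; inj₁; inj₂)
open import Data.Sign using (Sign; opposite) renaming (_*_ to _*ₛ_)
open import Data.Sign.Properties using (s*s≡+; *-comm; *-assoc; *-commutativeSemigroup)
open import Algebra.Properties.CommutativeSemigroup *-commutativeSemigroup using (interchange)
open import Function using (_∘_)
open import Induction.WellFounded using (Acc; acc)
open import Relation.Binary.Core using (Rel)
open import Relation.Binary.Definitions using (Tri; tri<; tri≈; tri>)
open import Relation.Binary.Construct.Closure.ReflexiveTransitive using (Star; ε; _◅_; _◅◅_)
open import Relation.Binary.PropositionalEquality
  using (_≡_; _≢_; refl; sym; trans; cong; cong₂; subst; subst₂; ≢-sym; module ≡-Reasoning)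
open import Relation.Nullary using (¬_; yes; no; contradiction)
open import Relation.Nullary.Decidable using (¬?; _×-dec_; decidable-stable)
open import Relation.Unary using (Pred; Decidable)

open ≡-Reasoning

signOf : Bool → Sign
signOf false = Sign.+
signOf true  = Sign.-

before-signOf : ∀ b → before (signOf b) ≡ b
before-signOf false = refl
before-signOf true  = refl

before-opposite-signOf : ∀ b → before (opposite (signOf b)) ≡ not b
before-opposite-signOf false = refl
before-opposite-signOf true  = refl

signProd-cong : ∀ k {s t : Fin k → Sign} → (∀ i → s i ≡ t i) → signProd k s ≡ signProd k t
signProd-cong zero    s≡t = refl
signProd-cong (suc k) s≡t = cong₂ _*ₛ_ (s≡t Fin.zero) (signProd-cong k (s≡t ∘ Fin.suc))

signProd-* : ∀ k (s t : Fin k → Sign) → signProd k (λ i → s i *ₛ t i) ≡ signProd k s *ₛ signProd k t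
signProd-* zero    s t = refl
signProd-* (suc k) s t = begin
  (s Fin.zero *ₛ t Fin.zero) *ₛ signProd k (λ i → s (Fin.suc i) *ₛ t (Fin.suc i))
    ≡⟨ cong ((s Fin.zero *ₛ t Fin.zero) *ₛ_) (signProd-* k (s ∘ Fin.suc) (t ∘ Fin.suc)) ⟩
  (s Fin.zero *ₛ t Fin.zero) *ₛ (signProd k (s ∘ Fin.suc) *ₛ signProd k (t ∘ Fin.suc))
    ≡⟨ interchange (s Fin.zero) (t Fin.zero) (signProd k (s ∘ Fin.suc)) (signProd k (t ∘ Fin.suc)) ⟩
  (s Fin.zero *ₛ signProd k (s ∘ Fin.suc)) *ₛ (t Fin.zero *ₛ signProd k (t ∘ Fin.suc)) ∎

signProd-snoc : ∀ k (s : Fin (suc k) → Sign) → signProd (suc k) s ≡ signProd k (s ∘ inject₁) *ₛ s (fromℕ k)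
signProd-snoc zero    s = *-comm (s Fin.zero) Sign.+
signProd-snoc (suc k) s = begin
  s Fin.zero *ₛ signProd (suc k) (s ∘ Fin.suc)
    ≡⟨ cong (s Fin.zero *ₛ_) (signProd-snoc k (s ∘ Fin.suc)) ⟩
  s Fin.zero *ₛ (signProd k (s ∘ Fin.suc ∘ inject₁) *ₛ s (fromℕ (suc k)))
    ≡⟨ *-assoc (s Fin.zero) _ _ ⟨
  signProd (suc k) (s ∘ inject₁) *ₛ s (fromℕ (suc k)) ∎

toℕ-next-< : ∀ {L} (k : Fin (suc L)) → toℕ k < L → toℕ (next k) ≡ suc (toℕ k)
toℕ-next-< k k<L = trans (toℕ-fromℕ< _) (m<n⇒m%n≡m (s≤s k<L))

next-last : ∀ {L} (k : Fin (suc L)) → toℕ k ≡ L → next k ≡ Fin.zero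
next-last {L} k k≡L =
  toℕ-injective (trans (toℕ-fromℕ< _) (trans (cong (λ m → suc m % suc L) k≡L) (n%n≡0 (suc L))))

signProd-∘next : ∀ L (s : Fin (suc L) → Sign) → signProd (suc L) (s ∘ next) ≡ signProd (suc L) s
signProd-∘next L s = begin
  signProd (suc L) (s ∘ next)                           ≡⟨ signProd-snoc L (s ∘ next) ⟩
  signProd L (s ∘ next ∘ inject₁) *ₛ s (next (fromℕ L)) ≡⟨ cong₂ _*ₛ_ (signProd-cong L (cong s ∘ next-inject₁))
                                                                      (cong s (next-last (fromℕ L) (toℕ-fromℕ L))) ⟩
  signProd L (s ∘ Fin.suc) *ₛ s Fin.zero                ≡⟨ *-comm _ (s Fin.zero) ⟩
  signProd (suc L) s                                    ∎
  where
  next-inject₁ : (i : Fin L) → next (inject₁ i) ≡ Fin.suc i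
  next-inject₁ i = toℕ-injective (trans (toℕ-next-< (inject₁ i) i<L) (cong suc (toℕ-inject₁ i)))
    where
    i<L : toℕ (inject₁ i) < L
    i<L = subst (_< L) (sym (toℕ-inject₁ i)) (toℕ<n i)

signProd-coboundary : ∀ L (c : Fin (suc L) → Sign) → signProd (suc L) (λ k → c k *ₛ c (next k)) ≡ Sign.+
signProd-coboundary L c = begin
  signProd (suc L) (λ k → c k *ₛ c (next k))       ≡⟨ signProd-* (suc L) c (c ∘ next) ⟩
  signProd (suc L) c *ₛ signProd (suc L) (c ∘ next) ≡⟨ cong (signProd (suc L) c *ₛ_) (signProd-∘next L c) ⟩
  signProd (suc L) c *ₛ signProd (suc L) c          ≡⟨ s*s≡+ (signProd (suc L) c) ⟩
  Sign.+                                            ∎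

least-witness : {P : Pred ℕ 0ℓ} → Decidable P → ∀ {m} → P m → ∃ λ j → P j × (∀ {k} → k < j → ¬ P k)
least-witness {P} P? {m} = go m (<-wellFounded m)
  where
  go : ∀ m → Acc _<_ m → P m → ∃ λ j → P j × (∀ {k} → k < j → ¬ P k)
  go m (acc rec) Pm with anyUpTo? P? m
  ... | yes (k , k<m , Pk) = go k (rec k<m) Pk
  ... | no none            = m , Pm , λ k<m Pk → none (_ , k<m , Pk)

module _ {n} (G : SignedDigraph n) (w : Fin n → Fin n → Sign) where

  BackwardWalk : (ℕ → Fin n) → Set
  BackwardWalk u = ∀ k → Arc G (u (suc k)) (u k) (w (u (suc k)) (u k))

  WeightedCycle : Set
  WeightedCycle = Σ (Cycle G) λ C → ∀ k → Cycle.sgn C k ≡ w (Cycle.vtx C k) (Cycle.vtx C (next k))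

  -- The walk u i ← u (i+1) ← ⋯ ← u (i+L+1) = u i, read backwards, is the cycle.
  lasso⇒cycle : ∀ u → BackwardWalk u → ∀ i L → u (i + suc L) ≡ u i
              → (∀ {a b} → a < b → b < i + suc L → u a ≢ u b) → WeightedCycle
  lasso⇒cycle u walk i L closed simple = cycle , λ _ → refl
    where
    idx : Fin (suc L) → ℕ
    idx k = i + (L ∸ toℕ k)

    idx< : ∀ k → idx k < i + suc L
    idx< k = +-monoʳ-< i (s≤s (m∸n≤m L (toℕ k)))

    idx-next : ∀ k → u (idx k) ≡ u (suc (idx (next k)))
    idx-next k with m≤n⇒m<n∨m≡n (s≤s⁻¹ (toℕ<n k))
    ... | inj₁ k<L = cong u (begin
      i + (L ∸ toℕ k)             ≡⟨ cong (i +_) (+-∸-assoc 1 k<L) ⟩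
      i + suc (L ∸ suc (toℕ k))   ≡⟨ +-suc i _ ⟩
      suc (i + (L ∸ suc (toℕ k))) ≡⟨ cong (λ t → suc (i + (L ∸ t))) (toℕ-next-< k k<L) ⟨
      suc (idx (next k))          ∎)
    ... | inj₂ k≡L = begin
      u (i + (L ∸ toℕ k))    ≡⟨ cong (λ t → u (i + (L ∸ t))) k≡L ⟩
      u (i + (L ∸ L))        ≡⟨ cong (λ t → u (i + t)) (n∸n≡0 L) ⟩
      u (i + 0)              ≡⟨ cong u (+-identityʳ i) ⟩
      u i                    ≡⟨ closed ⟨
      u (i + suc L)          ≡⟨ cong u (+-suc i L) ⟩
      u (suc (i + L))        ≡⟨ cong (λ k′ → u (suc (idx k′))) (next-last k k≡L) ⟨
      u (suc (idx (next k))) ∎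

    idx-injective : ∀ {a b} → u (idx a) ≡ u (idx b) → a ≡ b
    idx-injective {a} {b} e = toℕ-injective
      (∸-cancelˡ-≡ (s≤s⁻¹ (toℕ<n a)) (s≤s⁻¹ (toℕ<n b)) (+-cancelˡ-≡ i _ _ (same-index (<-cmp (idx a) (idx b)))))
      where
      same-index : Tri (idx a < idx b) (idx a ≡ idx b) (idx b < idx a) → idx a ≡ idx b
      same-index (tri< a<b _ _) = contradiction e (simple a<b (idx< b))
      same-index (tri≈ _ a≡b _) = a≡b
      same-index (tri> _ _ b<a) = contradiction (sym e) (simple b<a (idx< a))

    cycle : Cycle G
    cycle = record
      { len  = L
      ; vtx  = u ∘ idx
      ; sgn  = λ k → w (u (idx k)) (u (idx (next k)))
      ; inj  = idx-injective
      ; arcs = λ k → subst (λ v → Arc G v (u (idx (next k))) (w v (u (idx (next k)))))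
                           (sym (idx-next k)) (walk (idx (next k)))
      }

  backward-walk⇒cycle : ∀ u → BackwardWalk u → WeightedCycle
  backward-walk⇒cycle u walk with pigeonhole (n<1+n n) (u ∘ toℕ)
  ... | a , b , a<b , collision with least-witness (λ j → anyUpTo? (λ i → u i ≟ᶠ u j) j) (toℕ a , a<b , collision)
  ...   | j , (i , i<j , uᵢ≡uⱼ) , first = lasso⇒cycle u walk i L closed simple
    where
    L : ℕ
    L = j ∸ suc i

    i+1+L≡j : i + suc L ≡ j
    i+1+L≡j = trans (+-suc i L) (m+[n∸m]≡n i<j)

    closed : u (i + suc L) ≡ u i
    closed = trans (cong u i+1+L≡j) (sym uᵢ≡uⱼ)

    simple : ∀ {a b} → a < b → b < i + suc L → u a ≢ u b
    simple a<b b<j clash = first (subst (_ <_) i+1+L≡j b<j) (_ , a<b , clash)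

coboundary-cycle-positive : ∀ {n} {G : SignedDigraph n} (c : Fin n → Sign)
  → WeightedCycle G (λ a b → c a *ₛ c b) → ∃ λ (C : Cycle G) → cycleSign C ≡ Sign.+
coboundary-cycle-positive c (C , C-sgn) =
  C , trans (signProd-cong _ C-sgn) (signProd-coboundary (Cycle.len C) (c ∘ Cycle.vtx C))

predecessors⇒positive-cycle : ∀ {n} (G : SignedDigraph n) (P : Pred (Fin n) 0ℓ) (c : Fin n → Sign)
  → (∀ i → P i → ∃ λ j → P j × Arc G j i (c j *ₛ c i))
  → ∀ {i} → P i → ∃ λ (C : Cycle G) → cycleSign C ≡ Sign.+
predecessors⇒positive-cycle {n} G P c pred {i} Pi =
  coboundary-cycle-positive c (backward-walk⇒cycle G (λ a b → c a *ₛ c b) (proj₁ ∘ walk) step)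
  where
  back : Σ (Fin n) P → Σ (Fin n) P
  back (v , Pv) = proj₁ (pred v Pv) , proj₁ (proj₂ (pred v Pv))

  walk : ℕ → Σ (Fin n) P
  walk zero    = i , Pi
  walk (suc k) = back (walk k)

  step : BackwardWalk G (λ a b → c a *ₛ c b) (proj₁ ∘ walk)
  step k = proj₂ (proj₂ (pred (proj₁ (walk k)) (proj₂ (walk k))))

flipAt-involutive : ∀ {n} (j : Fin n) (w : Config n) → flipAt j (flipAt j w) ≡ w
flipAt-involutive j w = trans (updateAt-updateAt j w) (updateAt-id-local j w (not-involutive (lookup w j)))

flipAt-toward : ∀ {n} {j : Fin n} {w y : Config n} → lookup w j ≢ lookup y j → lookup (flipAt j w) j ≡ lookup y j
flipAt-toward {j = j} {w} wⱼ≢yⱼ = trans (lookup∘updateAt j w) (sym (¬-not (≢-sym wⱼ≢yⱼ)))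

differ-or-≡ : ∀ {n} (x y : Config n) → (∃ λ i → lookup x i ≢ lookup y i) ⊎ x ≡ y
differ-or-≡ x y with any? (λ i → ¬? (lookup x i ≟ lookup y i))
... | yes difference = inj₁ difference
... | no ¬difference = inj₂ (Pointwise-≡⇒≡ (ext λ i →
        decidable-stable (lookup x i ≟ lookup y i) (λ xᵢ≢yᵢ → ¬difference (i , xᵢ≢yᵢ))))

hamming : ∀ {n} → Config n → Config n → ℕ
hamming []      []      = 0
hamming (a ∷ x) (b ∷ y) = (if a xor b then 1 else 0) + hamming x y

hamming-comm : ∀ {n} (x y : Config n) → hamming x y ≡ hamming y x
hamming-comm []      []      = refl
hamming-comm (a ∷ x) (b ∷ y) = cong₂ (λ c d → (if c then 1 else 0) + d) (xor-comm a b) (hamming-comm x y)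

hamming-flipAt : ∀ {n} (i : Fin n) (x y : Config n) → lookup x i ≢ lookup y i → hamming (flipAt i x) y < hamming x y
hamming-flipAt Fin.zero    (false ∷ x) (false ∷ y) xᵢ≢yᵢ = contradiction refl xᵢ≢yᵢ
hamming-flipAt Fin.zero    (false ∷ x) (true  ∷ y) _     = n<1+n _
hamming-flipAt Fin.zero    (true  ∷ x) (false ∷ y) _     = n<1+n _
hamming-flipAt Fin.zero    (true  ∷ x) (true  ∷ y) xᵢ≢yᵢ = contradiction refl xᵢ≢yᵢ
hamming-flipAt (Fin.suc i) (a ∷ x)     (b ∷ y)     xᵢ≢yᵢ = +-monoʳ-< (if a xor b then 1 else 0) (hamming-flipAt i x y xᵢ≢yᵢ)

configs : ∀ n → List (Config n)
configs zero    = [ [] ]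
configs (suc n) = map (false ∷_) (configs n) ++ map (true ∷_) (configs n)

∈-configs : ∀ {n} (x : Config n) → x ∈ configs n
∈-configs []          = here refl
∈-configs (false ∷ x) = ∈-++⁺ˡ (∈-map⁺ (false ∷_) (∈-configs x))
∈-configs (true  ∷ x) = ∈-++⁺ʳ (map (false ∷_) (configs _)) (∈-map⁺ (true ∷_) (∈-configs x))

flip-changes⇒arc : ∀ {n} (f : BN n) {w : Config n} {i j : Fin n} {a b : Bool}
  → lookup w j ≡ a → lookup (f w) i ≡ b → lookup (f (flipAt j w)) i ≢ b
  → Arc (GraphOf f) j i (signOf a *ₛ signOf b)
flip-changes⇒arc f {w} {a = false} {b} wⱼ≡a fwᵢ≡b fw′ᵢ≢b =
  w , wⱼ≡a , trans fwᵢ≡b (sym (before-signOf b)) , trans (¬-not fw′ᵢ≢b) (cong not (sym (before-signOf b)))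
flip-changes⇒arc f {w} {i} {j} {true} {b} wⱼ≡a fwᵢ≡b fw′ᵢ≢b =
  flipAt j w , trans (lookup∘updateAt j w) (cong not wⱼ≡a) , trans (¬-not fw′ᵢ≢b) (sym (before-opposite-signOf b)) ,
  (begin
    lookup (f (flipAt j (flipAt j w))) i ≡⟨ cong (λ v → lookup (f v) i) (flipAt-involutive j w) ⟩
    lookup (f w) i                       ≡⟨ fwᵢ≡b ⟩
    b                                    ≡⟨ not-involutive b ⟨
    not (not b)                          ≡⟨ cong not (before-opposite-signOf b) ⟨
    not (before (opposite (signOf b)))   ∎)

-- w lies on a geodesic from x to y in the hypercube.
Between : ∀ {n} → Config n → Config n → Config n → Set
Between x y w = ∀ j → lookup w j ≢ lookup y j → lookup w j ≡ lookup x j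

between-flipAt : ∀ {n} {x y w : Config n} {j} → Between x y w → lookup w j ≢ lookup y j → Between x y (flipAt j w)
between-flipAt {y = y} {w} {j} btw wⱼ≢yⱼ m w′ₘ≢yₘ with m ≟ᶠ j
... | yes refl = contradiction (flipAt-toward {w = w} {y} wⱼ≢yⱼ) w′ₘ≢yₘ
... | no m≢j   = trans unchanged (btw m (λ wₘ≡yₘ → w′ₘ≢yₘ (trans unchanged wₘ≡yₘ)))
  where
  unchanged : lookup (flipAt j w) m ≡ lookup w m
  unchanged = lookup∘updateAt′ m j m≢j w

module _ {n} (f : BN n) (x y : Config n) (i : Fin n) {b : Bool} (fyᵢ≢b : lookup (f y) i ≢ b) where

  value-change⇒arc : ∀ w → Between x y w → lookup (f w) i ≡ b
                   → ∃ λ j → lookup x j ≢ lookup y j × Arc (GraphOf f) j i (signOf (lookup x j) *ₛ signOf b)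
  value-change⇒arc w = go w (<-wellFounded (hamming w y))
    where
    go : ∀ w → Acc _<_ (hamming w y) → Between x y w → lookup (f w) i ≡ b
       → ∃ λ j → lookup x j ≢ lookup y j × Arc (GraphOf f) j i (signOf (lookup x j) *ₛ signOf b)
    go w (acc rec) btw fwᵢ≡b with differ-or-≡ w y
    ... | inj₂ refl = contradiction fwᵢ≡b fyᵢ≢b
    ... | inj₁ (j , wⱼ≢yⱼ) with lookup (f (flipAt j w)) i ≟ b
    ...   | yes fw′ᵢ≡b = go (flipAt j w) (rec (hamming-flipAt j w y wⱼ≢yⱼ)) (between-flipAt {x = x} {y} {w} btw wⱼ≢yⱼ) fw′ᵢ≡b
    ...   | no  fw′ᵢ≢b = j , (λ xⱼ≡yⱼ → wⱼ≢yⱼ (trans wⱼ≡xⱼ xⱼ≡yⱼ)) , flip-changes⇒arc f wⱼ≡xⱼ fwᵢ≡b fw′ᵢ≢b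
      where
      wⱼ≡xⱼ : lookup w j ≡ lookup x j
      wⱼ≡xⱼ = btw j wⱼ≢yⱼ

FixesDiff : ∀ {n} → BN n → Config n → Config n → Set
FixesDiff f x y = ∀ i → lookup x i ≢ lookup y i → lookup (f x) i ≡ lookup x i

fixes-both⇒predecessor : ∀ {n} {f : BN n} {x y : Config n} → FixesDiff f x y → FixesDiff f y x
  → ∀ i → lookup x i ≢ lookup y i
  → ∃ λ j → lookup x j ≢ lookup y j × Arc (GraphOf f) j i (signOf (lookup x j) *ₛ signOf (lookup x i))
fixes-both⇒predecessor {f = f} {x} {y} fixesˣ fixesʸ i xᵢ≢yᵢ =
  value-change⇒arc f x y i fyᵢ≢xᵢ x (λ _ _ → refl) (fixesˣ i xᵢ≢yᵢ)
  where
  fyᵢ≢xᵢ : lookup (f y) i ≢ lookup x i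
  fyᵢ≢xᵢ = subst (_≢ lookup x i) (sym (fixesʸ i (≢-sym xᵢ≢yᵢ))) (≢-sym xᵢ≢yᵢ)

fixes-both⇒≡ : ∀ {n} {G : SignedDigraph n} {f : BN n} → AllCyclesNegative G → SpanningSubgraph (GraphOf f) G
  → ∀ {x y} → FixesDiff f x y → FixesDiff f y x → x ≡ y
fixes-both⇒≡ {G = G} {f} neg f⊆G {x} {y} fixesˣ fixesʸ with differ-or-≡ x y
... | inj₂ x≡y = x≡y
... | inj₁ (i , xᵢ≢yᵢ) = contradiction (trans (sym (proj₂ positive)) (neg (proj₁ positive))) λ ()
  where
  predecessor : ∀ i → lookup x i ≢ lookup y i
              → ∃ λ j → lookup x j ≢ lookup y j × Arc G j i (signOf (lookup x j) *ₛ signOf (lookup x i))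
  predecessor i xᵢ≢yᵢ with fixes-both⇒predecessor {f = f} {x} {y} fixesˣ fixesʸ i xᵢ≢yᵢ
  ... | j , xⱼ≢yⱼ , arc = j , xⱼ≢yⱼ , f⊆G _ _ _ arc

  positive : ∃ λ (C : Cycle G) → cycleSign C ≡ Sign.+
  positive = predecessors⇒positive-cycle G _ (signOf ∘ lookup x) predecessor xᵢ≢yᵢ

Joinable : {A : Set} → Rel A 0ℓ → A → A → Set
Joinable R x y = ∃ λ w → Star R x w × Star R y w

common-descendant : {A : Set} {R : Rel A 0ℓ} → (∀ x y → Joinable R x y)
  → ∀ z (xs : List A) → ∃ λ w → Star R z w × (∀ {x} → x ∈ xs → Star R x w)
common-descendant join z []       = z , ε , λ ()
common-descendant join z (x ∷ xs) with common-descendant join z xs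
... | w , z↝w , xs↝w with join w x
...   | v , w↝v , x↝v = v , z↝w ◅◅ w↝v , λ { (here refl) → x↝v ; (there x∈xs) → xs↝w x∈xs ◅◅ w↝v }

joinable⇒sink : ∀ {n} {R : Rel (Config n) 0ℓ} → (∀ x y → Joinable R x y) → ∃ λ z → ∀ x → Star R x z
joinable⇒sink {n} join with common-descendant join (replicate n false) (configs n)
... | z , _ , ↝z = z , λ x → ↝z (∈-configs x)

trap-closed : ∀ {n} {R : Rel (Config n) 0ℓ} {T : Subset n} → IsTrapSet R T → ∀ {a b} → Star R a b → T a → T b
trap-closed trap ε        Ta = Ta
trap-closed trap (r ◅ rs) Ta = trap-closed trap rs (trap _ _ Ta r)

sink⇒unique-attractor : ∀ {n} {R : Rel (Config n) 0ℓ} {z} → (∀ x → Star R x z) → HasUniqueAttractor R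
sink⇒unique-attractor {R = R} {z} ↝z =
  Star R z , ((z , ε) , trap , λ T T≠∅ T-trap _ → ⊆-trap T≠∅ T-trap) ,
  λ B (B≠∅ , B-trap , B-minimal) → ⊆-trap B≠∅ B-trap , B-minimal (Star R z) (z , ε) trap (⊆-trap B≠∅ B-trap)
  where
  trap : IsTrapSet R (Star R z)
  trap _ _ z↝a r = z↝a ◅◅ (r ◅ ε)

  ⊆-trap : ∀ {T} → Nonempty T → IsTrapSet R T → ∀ {c} → Star R z c → T c
  ⊆-trap (t , Tt) T-trap z↝c = trap-closed T-trap z↝c (trap-closed T-trap (↝z t) Tt)

module _ {n} (F : List (BN n)) where

  step-or-fixes : ∀ x y → (∃ λ i → lookup x i ≢ lookup y i × UnionArc F x (flipAt i x)) ⊎ (∀ f → f ∈ F → FixesDiff f x y)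
  step-or-fixes x y with any? (λ i → ¬? (lookup x i ≟ lookup y i) ×-dec Any.any? (λ f → ¬? (lookup (f x) i ≟ lookup x i)) F)
  ... | yes (i , xᵢ≢yᵢ , moves) with find moves
  ...   | f , f∈F , fxᵢ≢xᵢ = inj₁ (i , xᵢ≢yᵢ , f , f∈F , i , fxᵢ≢xᵢ , refl)
  step-or-fixes x y | no ¬step = inj₂ λ f f∈F i xᵢ≢yᵢ →
    decidable-stable (lookup (f x) i ≟ lookup x i) λ fxᵢ≢xᵢ → ¬step (i , xᵢ≢yᵢ , lose f∈F fxᵢ≢xᵢ)

  union-joinable : (∀ {x y} → (∀ f → f ∈ F → FixesDiff f x y) → (∀ f → f ∈ F → FixesDiff f y x) → x ≡ y)
                 → ∀ x y → Joinable (UnionArc F) x y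
  union-joinable fixed⇒≡ x y = go x y (<-wellFounded (hamming x y))
    where
    go : ∀ x y → Acc _<_ (hamming x y) → Joinable (UnionArc F) x y
    go x y (acc rec) with step-or-fixes x y | step-or-fixes y x
    ... | inj₁ (i , xᵢ≢yᵢ , x→x′) | _
        with go (flipAt i x) y (rec (hamming-flipAt i x y xᵢ≢yᵢ))
    ...   | w , x′↝w , y↝w = w , x→x′ ◅ x′↝w , y↝w
    go x y (acc rec) | inj₂ _ | inj₁ (i , yᵢ≢xᵢ , y→y′)
        with go x (flipAt i y) (rec (subst₂ _<_ (hamming-comm (flipAt i y) x) (hamming-comm y x) (hamming-flipAt i y x yᵢ≢xᵢ)))
    ...   | w , x↝w , y′↝w = w , x↝w , y→y′ ◅ y′↝w
    go x y (acc rec) | inj₂ fixesˣ | inj₂ fixesʸ =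
      x , ε , subst (λ v → Star (UnionArc F) v x) (fixed⇒≡ fixesˣ fixesʸ) ε

lemma16 : (n : ℕ) (G : SignedDigraph n) → AllCyclesNegative G → RobustlyConverging G
lemma16 n G neg []        F≢[] _    = contradiction refl F≢[]
lemma16 n G neg F@(f ∷ _) _    span = sink⇒unique-attractor (proj₂ (joinable⇒sink joinable))
  where
  joinable : ∀ x y → Joinable (UnionArc F) x y
  joinable = union-joinable F λ {x} {y} fixesˣ fixesʸ →
    fixes-both⇒≡ {f = f} neg (span f (here refl)) {x} {y} (fixesˣ f (here refl)) (fixesʸ f (here refl))
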